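{- For every even integer $n\geqslant 6$, the bagel $B_n$, with every vertex declared a root, has no rooted $K_{2,5}$ minor (equivalently, $B_n$ has no $K_{2,5}$ minor).
   Context: For $p\geqslant 3$ and $n=2p$, the bagel is $B_n:=K_2\boxtimes C_p$, the strong product of an edge and the cycle $C_p$: it has vertices $v_1,\dots,v_p,w_1,\dots,w_p$, with $v_1\cdots v_p$ and $w_1\cdots w_p$ forming cycles and $v_i$ adjacent to $w_j$ iff $i-j\in\{0,\pm1\}$ modulo $p$. (The strong product $G\boxtimes H$ has vertex set $V(G)\times V(H)$, with $(u,v)(u',v')$ an edge iff $u=u'$ and $vv'\in E(H)$, or $uu'\in E(G)$ and $v=v'$, or $uu'\in E(G)$ and $vv'\in E(H)$.) A rooted $K_{2,t}$ minor of a rooted graph $(G,R)$ is a sequence $(X_1,X_2;Y_1,\dots,Y_t)$ of pairwise disjoint vertex sets each inducing a connected subgraph, with an edge between $X_i$ and $Y_j$ for all $i\in[2]$, $j\in[t]$, and each $Y_j$ containing a vertex of $R$. -}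

module Defs where

open import Data.Nat using (ℕ; suc; _+_; _%_; _≤_; _*_; NonZero)
open import Data.Fin using (Fin; toℕ)
open import Data.Product using (_×_; Σ; ∃; ∃-syntax; _,_)
open import Data.Sum using (_⊎_)
open import Data.List using (List; []; _∷_)
open import Data.Empty using (⊥)
open import Data.Unit using (⊤)
open import Relation.Nullary using (¬_)
open import Relation.Binary.PropositionalEquality using (_≡_)
open import Level using (0ℓ)

record Graph : Set₁ where
  field
    V   : Set
    Adj : V → V → Set

open Graph public

Subset : Set → Set₁
Subset V = V → Set

data WalkIn (G : Graph) (X : Subset (V G)) : V G → V G → Set where
  here : ∀ {u} → X u → WalkIn G X u u
  step : ∀ {u w v} → X u → Adj G u w → WalkIn G X w v → WalkIn G X u v

Connected : (G : Graph) → Subset (V G) → Set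
Connected G X = (∃[ x ] X x) × (∀ u v → X u → X v → WalkIn G X u v)

Disjoint : {A : Set} → Subset A → Subset A → Set
Disjoint X Y = ∀ a → X a → Y a → ⊥

EdgeBetween : (G : Graph) → Subset (V G) → Subset (V G) → Set
EdgeBetween G X Y = ∃[ x ] ∃[ y ] (X x × Y y × Adj G x y)

record RootedK2tMinor (G : Graph) (R : Subset (V G)) (t : ℕ) : Set₁ where
  field
    X₁ X₂ : Subset (V G)
    Y     : Fin t → Subset (V G)
    X₁-conn : Connected G X₁
    X₂-conn : Connected G X₂
    Y-conn  : ∀ j → Connected G (Y j)
    X₁X₂-disj : Disjoint X₁ X₂
    X₁Y-disj  : ∀ j → Disjoint X₁ (Y j)
    X₂Y-disj  : ∀ j → Disjoint X₂ (Y j)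
    YY-disj   : ∀ j k → ¬ (j ≡ k) → Disjoint (Y j) (Y k)
    X₁Y-edge  : ∀ j → EdgeBetween G X₁ (Y j)
    X₂Y-edge  : ∀ j → EdgeBetween G X₂ (Y j)
    Y-root    : ∀ j → ∃[ r ] (Y j r × R r)

CycAdj : (p : ℕ) .{{_ : NonZero p}} → Fin p → Fin p → Set
CycAdj p i j = (toℕ j ≡ (toℕ i + 1) % p) ⊎ (toℕ i ≡ (toℕ j + 1) % p)

-- The bagel B_{2p} = K_2 ⊠ C_p : vertices (a , i) with a ∈ Fin 2
-- (v_i for a = 0, w_i for a = 1); distinct vertices (a,i),(b,j) are
-- adjacent iff i - j ∈ {0, ±1} mod p.
Bagel : (p : ℕ) .{{_ : NonZero p}} → Graph
Bagel p = record
  { V   = Fin 2 × Fin p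
  ; Adj = λ { (a , i) (b , j) →
              ¬ ((a , i) ≡ (b , j)) × (i ≡ j ⊎ CycAdj p i j) }
  }

AllRoots : (G : Graph) → Subset (V G)
AllRoots G _ = ⊤

-- Contract every Y j onto the endpoint y j of its edge to X₂ and absorb into X₁ the part
-- of Y j reachable from X₁ while avoiding y j.  This leaves disjoint connected sets A, B
-- and five distinct vertices, outside A ∪ B, each adjacent to both.  A column {vᵢ, wᵢ} of
-- the bagel has only two vertices, so it cannot contain such a vertex and also meet both A
-- and B; hence each of the five lies in a column missed by A or by B, and three of them
-- lie in distinct columns missed by the same set, say A.  Projecting A onto C_p gives a
-- connected set of the cycle that avoids three vertices and is adjacent to all of them,
-- which is impossible: deleting three vertices cuts C_p into arcs, each adjacent to at
-- most two of them.

module Submission where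

open import Defs
open import Data.Empty using (⊥; ⊥-elim)
open import Data.Fin using (Fin; zero; suc; toℕ)
open import Data.Fin.Patterns using (0F; 1F; 2F)
open import Data.Fin.Properties using (_≟_; toℕ<n; toℕ-injective; suc-injective)
open import Data.Nat using (ℕ; zero; suc; _+_; _∸_; _*_; _%_; _≤_; _<_; _<?_; s≤s⁻¹; s<s⁻¹; NonZero)
open import Data.Nat.DivMod using (%-distribˡ-+; m%n%n≡m%n; [m+n]%n≡m%n; m<n⇒m%n≡m; n%n≡0; m%n≤m; m%n<n)
open import Data.Nat.Properties
  using (+-assoc; +-comm; +-suc; <⇒≤; ≤-refl; ≤-trans; ≤-antisym; ≤∧≢⇒<; ≮⇒≥; n≤1+n; n≢0⇒n>0; 1+n≢0;
         <-cmp; <-irrefl; <-asym; m+[n∸m]≡n; m∸n+n≡m; module ≤-Reasoning)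
open import Data.Product using (Σ-syntax; ∃-syntax; _×_; _,_; proj₁; proj₂)
open import Data.Product.Properties using (≡-dec)
open import Data.Sum using (_⊎_; inj₁; inj₂; [_,_]′) renaming (map to ⊎-map)
open import Function using (_∘_; id)
open import Function.Definitions using (Injective)
open import Relation.Binary.Definitions using (Symmetric; DecidableEquality; tri<; tri≈; tri>)
open import Relation.Binary.PropositionalEquality
  using (_≡_; _≢_; refl; sym; trans; cong; subst; module ≡-Reasoning)
open import Relation.Nullary using (¬_; Dec; yes; no)
open import Relation.Nullary.Decidable using (¬¬-excluded-middle)
open import Relation.Unary using (_∪_; _∖_; ｛_｝; _⊆_; ⋃)

Preconnected : (G : Graph) → Subset (V G) → Set
Preconnected G X = ∀ u v → X u → X v → WalkIn G X u v

Boundary : (G : Graph) → Subset (V G) → Subset (V G)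
Boundary G X v = ¬ X v × ∃[ h ] (X h × Adj G h v)

walk-map : ∀ {G H : Graph} {X : Subset (V G)} {Y : Subset (V H)} (f : V G → V H) →
           (∀ {x y} → Adj G x y → Adj H (f x) (f y)) → (∀ {x} → X x → Y (f x)) →
           ∀ {u v} → WalkIn G X u v → WalkIn H Y (f u) (f v)
walk-map f f-adj f-mem (here x)     = here (f-mem x)
walk-map f f-adj f-mem (step x a w) = step (f-mem x) (f-adj a) (walk-map f f-adj f-mem w)

module _ {G : Graph} where

  walk-mono : ∀ {X Y : Subset (V G)} → X ⊆ Y → ∀ {u v} → WalkIn G X u v → WalkIn G Y u v
  walk-mono X⊆Y = walk-map id id X⊆Y

  module _ {X : Subset (V G)} where

    walk-head : ∀ {u v} → WalkIn G X u v → X u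
    walk-head (here x)     = x
    walk-head (step x _ _) = x

    walk-last : ∀ {u v} → WalkIn G X u v → X v
    walk-last (here x)     = x
    walk-last (step _ _ w) = walk-last w

    infixr 5 _++ʷ_
    _++ʷ_ : ∀ {u v w} → WalkIn G X u v → WalkIn G X v w → WalkIn G X u w
    here _     ++ʷ w′ = w′
    step x a w ++ʷ w′ = step x a (w ++ʷ w′)

    walk-reverse : Symmetric (Adj G) → ∀ {u v} → WalkIn G X u v → WalkIn G X v u
    walk-reverse adj-sym (here x)     = here x
    walk-reverse adj-sym (step x a w) = walk-reverse adj-sym w ++ʷ step (walk-head w) (adj-sym a) (here x)

    preconnected-from : Symmetric (Adj G) → ∀ x₀ → (∀ {z} → X z → WalkIn G X x₀ z) → Preconnected G X
    preconnected-from adj-sym x₀ reach u v u∈X v∈X = walk-reverse adj-sym (reach u∈X) ++ʷ reach v∈X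

    walk-reachable : ∀ {u v} → WalkIn G X u v → WalkIn G (WalkIn G X u) u v
    walk-reachable (here x)     = here (here x)
    walk-reachable (step x a w) = step (here x) a (walk-mono (step x a) (walk-reachable w))

    walk-first-arrival : DecidableEquality (V G) → ∀ {u v} → WalkIn G X u v →
                         u ≡ v ⊎ ∃[ z ] (WalkIn G (X ∖ ｛ v ｝) u z × Adj G z v)
    walk-first-arrival _≟ᵛ_ (here x) = inj₁ refl
    walk-first-arrival _≟ᵛ_ {u} {v} (step x a w) with v ≟ᵛ u | walk-first-arrival _≟ᵛ_ w
    ... | yes v≡u | _                   = inj₁ (sym v≡u)
    ... | no v≢u  | inj₁ refl           = inj₂ (u , here (x , v≢u) , a)
    ... | no v≢u  | inj₂ (z , w′ , z~v) = inj₂ (z , step (x , v≢u) a w′ , z~v)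

record SingletonK2tMinor (G : Graph) (t : ℕ) : Set₁ where
  field
    A B     : Subset (V G)
    A-conn  : Preconnected G A
    B-conn  : Preconnected G B
    AB-disj : Disjoint A B
    y       : Fin t → V G
    y-inj   : Injective _≡_ _≡_ y
    y∉A     : ∀ j → ¬ A (y j)
    y∉B     : ∀ j → ¬ B (y j)
    A-edge  : ∀ j → ∃[ a ] (A a × Adj G a (y j))
    B-edge  : ∀ j → ∃[ b ] (B b × Adj G b (y j))

module Edge {G : Graph} {X Y : Subset (V G)} (e : EdgeBetween G X Y) where
  from to : V G
  from = proj₁ e
  to   = proj₁ (proj₂ e)
  from∈ : X from
  from∈ = proj₁ (proj₂ (proj₂ e))
  to∈ : Y to
  to∈ = proj₁ (proj₂ (proj₂ (proj₂ e)))
  adj : Adj G from to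
  adj = proj₂ (proj₂ (proj₂ (proj₂ e)))

singleton-minor : ∀ {G R t} → Symmetric (Adj G) → DecidableEquality (V G) →
                  RootedK2tMinor G R t → SingletonK2tMinor G t
singleton-minor {G} {R} {t} adj-sym _≟ᵛ_ m = record
  { A = A ; B = X₂ ; A-conn = A-conn ; B-conn = proj₂ X₂-conn ; AB-disj = AB-disj
  ; y = y ; y-inj = y-inj ; y∉A = y∉A ; y∉B = λ j y∈X₂ → X₂Y-disj j _ y∈X₂ (E₂.to∈ j)
  ; A-edge = A-edge ; B-edge = λ j → E₂.from j , E₂.from∈ j , E₂.adj j
  }
  where
  open RootedK2tMinor m
  module E₁ (j : Fin t) = Edge (X₁Y-edge j)
  module E₂ (j : Fin t) = Edge (X₂Y-edge j)

  y : Fin t → V G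
  y = E₂.to

  Tail : Fin t → Subset (V G)
  Tail j = WalkIn G (Y j ∖ ｛ y j ｝) (E₁.to j)

  A : Subset (V G)
  A = X₁ ∪ ⋃ (Fin t) Tail

  tail⊆Y : ∀ {j z} → Tail j z → Y j z
  tail⊆Y w = proj₁ (walk-last w)

  x₀ : V G
  x₀ = proj₁ (proj₁ X₁-conn)

  walk-X₁ : ∀ {z} → X₁ z → WalkIn G A x₀ z
  walk-X₁ = walk-mono inj₁ ∘ proj₂ X₁-conn _ _ (proj₂ (proj₁ X₁-conn))

  A-conn : Preconnected G A
  A-conn = preconnected-from adj-sym x₀ λ
    { (inj₁ z∈X₁)    → walk-X₁ z∈X₁
    ; (inj₂ (j , w)) → walk-X₁ (E₁.from∈ j) ++ʷ
                       step (inj₁ (E₁.from∈ j)) (E₁.adj j) (walk-mono (λ w′ → inj₂ (j , w′)) (walk-reachable w)) }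

  AB-disj : Disjoint A X₂
  AB-disj z (inj₁ z∈X₁)    z∈X₂ = X₁X₂-disj z z∈X₁ z∈X₂
  AB-disj z (inj₂ (k , w)) z∈X₂ = X₂Y-disj k z z∈X₂ (tail⊆Y w)

  y-inj : Injective _≡_ _≡_ y
  y-inj {j} {k} yj≡yk with j ≟ k
  ... | yes j≡k = j≡k
  ... | no j≢k  = ⊥-elim (YY-disj j k j≢k (y j) (E₂.to∈ j) (subst (Y k) (sym yj≡yk) (E₂.to∈ k)))

  y∉A : ∀ j → ¬ A (y j)
  y∉A j (inj₁ y∈X₁) = X₁Y-disj j (y j) y∈X₁ (E₂.to∈ j)
  y∉A j (inj₂ (k , w)) with y k ≟ᵛ y j
  ... | yes yk≡yj = proj₂ (walk-last w) yk≡yj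
  ... | no yk≢yj  = YY-disj k j (yk≢yj ∘ cong y) (y j) (tail⊆Y w) (E₂.to∈ j)

  A-edge : ∀ j → ∃[ a ] (A a × Adj G a (y j))
  A-edge j with walk-first-arrival _≟ᵛ_ (proj₂ (Y-conn j) _ _ (E₁.to∈ j) (E₂.to∈ j))
  ... | inj₁ u≡y           = E₁.from j , inj₁ (E₁.from∈ j) , subst (Adj G (E₁.from j)) u≡y (E₁.adj j)
  ... | inj₂ (z , w , z~y) = z , inj₂ (j , w) , z~y

¬¬-Π-Fin : ∀ {n} {P : Fin n → Set} → (∀ i → ¬ ¬ P i) → ¬ ¬ (∀ i → P i)
¬¬-Π-Fin {zero}  ¬¬P k = k (λ ())
¬¬-Π-Fin {suc n} ¬¬P k =
  ¬¬P zero λ P₀ → ¬¬-Π-Fin (¬¬P ∘ suc) λ P₊ → k λ { zero → P₀ ; (suc i) → P₊ i }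

AtLeast : ∀ {N} → ℕ → (Fin N → Set) → Set
AtLeast {N} k P = Σ[ ι ∈ (Fin k → Fin N) ] (Injective _≡_ _≡_ ι × ∀ i → P (ι i))

module _ {N} {P : Fin (suc N) → Set} where

  atLeast-one : ∀ {j} → P j → AtLeast 1 P
  atLeast-one {j} Pj = (λ _ → j) , (λ { {zero} {zero} _ → refl }) , λ _ → Pj

  atLeast-lift : ∀ {k} → AtLeast k (P ∘ suc) → AtLeast k P
  atLeast-lift (ι , ι-inj , Pι) = suc ∘ ι , ι-inj ∘ suc-injective , Pι

  atLeast-cons : ∀ {k} → P zero → AtLeast k (P ∘ suc) → AtLeast (suc k) P
  atLeast-cons {k} P₀ (ι , ι-inj , Pι) = ι′ , ι′-inj , Pι′
    where
    ι′ : Fin (suc k) → Fin (suc N)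
    ι′ zero    = zero
    ι′ (suc i) = suc (ι i)
    ι′-inj : Injective _≡_ _≡_ ι′
    ι′-inj {zero}  {zero}  _ = refl
    ι′-inj {suc i} {suc j} e = cong suc (ι-inj (suc-injective e))
    Pι′ : ∀ i → P (ι′ i)
    Pι′ zero    = P₀
    Pι′ (suc i) = Pι i

pigeonhole-⊎ : ∀ {N} m n {A B : Fin N → Set} → m + n < N → (∀ j → A j ⊎ B j) →
               AtLeast (suc m) A ⊎ AtLeast (suc n) B
pigeonhole-⊎ {zero} _ _ () _
pigeonhole-⊎ {suc N} m n {A} {B} m+n<N split with split zero | m | n
... | inj₁ A₀ | zero  | _     = inj₁ (atLeast-one {P = A} A₀)
... | inj₂ B₀ | _     | zero  = inj₂ (atLeast-one {P = B} B₀)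
... | inj₁ A₀ | suc m | n     = ⊎-map (atLeast-cons {P = A} A₀) (atLeast-lift {P = B})
                                   (pigeonhole-⊎ m n (s<s⁻¹ m+n<N) (split ∘ suc))
... | inj₂ B₀ | m     | suc n = ⊎-map (atLeast-lift {P = A}) (atLeast-cons {P = B} B₀)
                                   (pigeonhole-⊎ m n (s<s⁻¹ (subst (_< suc N) (+-suc m n) m+n<N)) (split ∘ suc))

fin2-pigeonhole : (a b c : Fin 2) → a ≡ b ⊎ a ≡ c ⊎ b ≡ c
fin2-pigeonhole 0F 0F _  = inj₁ refl
fin2-pigeonhole 1F 1F _  = inj₁ refl
fin2-pigeonhole 0F 1F 0F = inj₂ (inj₁ refl)
fin2-pigeonhole 0F 1F 1F = inj₂ (inj₂ refl)
fin2-pigeonhole 1F 0F 0F = inj₂ (inj₂ refl)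
fin2-pigeonhole 1F 0F 1F = inj₂ (inj₁ refl)

module _ (p : ℕ) .{{_ : NonZero p}} where

  Near : Fin p → Fin p → Set
  Near i j = i ≡ j ⊎ CycAdj p i j

  near-sym : Symmetric Near
  near-sym (inj₁ i≡j)          = inj₁ (sym i≡j)
  near-sym (inj₂ (inj₁ j≡i+1)) = inj₂ (inj₂ j≡i+1)
  near-sym (inj₂ (inj₂ i≡j+1)) = inj₂ (inj₁ i≡j+1)

  ReflexiveCycle : Graph
  ReflexiveCycle = record { V = Fin p ; Adj = Near }

  -- offset g c is the number of forward steps along the cycle from g to c.
  offset : Fin p → Fin p → ℕ
  offset g c = (toℕ c + (p ∸ toℕ g)) % p

  [m%p+n]%p≡[m+n]%p : ∀ m n → (m % p + n) % p ≡ (m + n) % p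
  [m%p+n]%p≡[m+n]%p m n = begin
    (m % p + n) % p          ≡⟨ %-distribˡ-+ (m % p) n p ⟩
    (m % p % p + n % p) % p  ≡⟨ cong (λ k → (k + n % p) % p) (m%n%n≡m%n m p) ⟩
    (m % p + n % p) % p      ≡⟨ %-distribˡ-+ m n p ⟨
    (m + n) % p              ∎
    where open ≡-Reasoning

  [m+1]%p≡1+m⊎1+m≡p : ∀ m → m < p → (m + 1) % p ≡ suc m ⊎ suc m ≡ p
  [m+1]%p≡1+m⊎1+m≡p m m<p with suc m <? p
  ... | yes 1+m<p = inj₁ (trans (cong (_% p) (+-comm m 1)) (m<n⇒m%n≡m 1+m<p))
  ... | no  1+m≮p = inj₂ (≤-antisym m<p (≮⇒≥ 1+m≮p))

  module _ (g : Fin p) where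

    offset<p : ∀ c → offset g c < p
    offset<p c = m%n<n _ p

    offset-origin : offset g g ≡ 0
    offset-origin = trans (cong (_% p) (m+[n∸m]≡n (<⇒≤ (toℕ<n g)))) (n%n≡0 p)

    offset+origin : ∀ c → (offset g c + toℕ g) % p ≡ toℕ c
    offset+origin c = begin
      ((toℕ c + (p ∸ toℕ g)) % p + toℕ g) % p ≡⟨ [m%p+n]%p≡[m+n]%p (toℕ c + (p ∸ toℕ g)) (toℕ g) ⟩
      (toℕ c + (p ∸ toℕ g) + toℕ g) % p       ≡⟨ cong (_% p) (+-assoc (toℕ c) _ _) ⟩
      (toℕ c + ((p ∸ toℕ g) + toℕ g)) % p     ≡⟨ cong (λ k → (toℕ c + k) % p) (m∸n+n≡m (<⇒≤ (toℕ<n g))) ⟩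
      (toℕ c + p) % p                         ≡⟨ [m+n]%n≡m%n (toℕ c) p ⟩
      toℕ c % p                               ≡⟨ m<n⇒m%n≡m (toℕ<n c) ⟩
      toℕ c                                   ∎
      where open ≡-Reasoning

    offset-injective : Injective _≡_ _≡_ (offset g)
    offset-injective {c} {c′} e = toℕ-injective (begin
      toℕ c                     ≡⟨ offset+origin c ⟨
      (offset g c + toℕ g) % p  ≡⟨ cong (λ k → (k + toℕ g) % p) e ⟩
      (offset g c′ + toℕ g) % p ≡⟨ offset+origin c′ ⟩
      toℕ c′                    ∎)
      where open ≡-Reasoning

    offset≢0 : ∀ {c} → c ≢ g → offset g c ≢ 0
    offset≢0 c≢g e = c≢g (offset-injective (trans e (sym offset-origin)))

    offset-suc : ∀ {i j} → toℕ j ≡ (toℕ i + 1) % p → offset g j ≡ (offset g i + 1) % p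
    offset-suc {i} {j} j≡i+1 = begin
      (toℕ j + k) % p           ≡⟨ cong (λ n → (n + k) % p) j≡i+1 ⟩
      ((toℕ i + 1) % p + k) % p ≡⟨ [m%p+n]%p≡[m+n]%p (toℕ i + 1) k ⟩
      (toℕ i + 1 + k) % p       ≡⟨ cong (_% p) (+-assoc (toℕ i) 1 k) ⟩
      (toℕ i + (1 + k)) % p     ≡⟨ cong (λ n → (toℕ i + n) % p) (+-comm 1 k) ⟩
      (toℕ i + (k + 1)) % p     ≡⟨ cong (_% p) (+-assoc (toℕ i) k 1) ⟨
      (toℕ i + k + 1) % p       ≡⟨ [m%p+n]%p≡[m+n]%p (toℕ i + k) 1 ⟨
      ((toℕ i + k) % p + 1) % p ∎
      where open ≡-Reasoning
            k = p ∸ toℕ g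

    offset-step : ∀ {i j} → Near i j → i ≢ g → offset g j ≤ suc (offset g i)
    offset-step (inj₁ refl) _ = n≤1+n _
    offset-step {i} {j} (inj₂ (inj₁ j≡i+1)) _ = begin
      offset g j             ≡⟨ offset-suc j≡i+1 ⟩
      (offset g i + 1) % p   ≤⟨ m%n≤m _ p ⟩
      offset g i + 1         ≡⟨ +-comm (offset g i) 1 ⟩
      suc (offset g i)       ∎
      where open ≤-Reasoning
    offset-step {i} {j} (inj₂ (inj₂ i≡j+1)) i≢g with [m+1]%p≡1+m⊎1+m≡p (offset g j) (offset<p j)
    ... | inj₁ no-wrap = begin
      offset g j             ≤⟨ n≤1+n _ ⟩
      suc (offset g j)       ≡⟨ trans (offset-suc i≡j+1) no-wrap ⟨
      offset g i             ≤⟨ n≤1+n _ ⟩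
      suc (offset g i)       ∎
      where open ≤-Reasoning
    ... | inj₂ wrap = ⊥-elim (offset≢0 i≢g (begin
      offset g i             ≡⟨ offset-suc i≡j+1 ⟩
      (offset g j + 1) % p   ≡⟨ cong (_% p) (trans (+-comm (offset g j) 1) wrap) ⟩
      p % p                  ≡⟨ n%n≡0 p ⟩
      0                      ∎))
      where open ≡-Reasoning

    offset-near-origin : ∀ {c} → Near c g → c ≢ g → offset g c ≤ 1 ⊎ suc (offset g c) ≡ p
    offset-near-origin (inj₁ c≡g) c≢g = ⊥-elim (c≢g c≡g)
    offset-near-origin {c} (inj₂ (inj₁ g≡c+1)) _ with [m+1]%p≡1+m⊎1+m≡p (offset g c) (offset<p c)
    ... | inj₁ no-wrap = ⊥-elim (1+n≢0 (trans (sym no-wrap) (trans (sym (offset-suc g≡c+1)) offset-origin)))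
    ... | inj₂ wrap    = inj₂ wrap
    offset-near-origin {c} (inj₂ (inj₂ c≡g+1)) _ = inj₁ (begin
      offset g c             ≡⟨ offset-suc c≡g+1 ⟩
      (offset g g + 1) % p   ≡⟨ cong (λ n → (n + 1) % p) offset-origin ⟩
      1 % p                  ≤⟨ m%n≤m 1 p ⟩
      1                      ∎)
      where open ≤-Reasoning

  module _ {T : Subset (Fin p)} (T-conn : Preconnected ReflexiveCycle T) {g : Fin p} (g∉T : ¬ T g) where

    private
      ∈∉⇒≢ : ∀ {c b} → T c → ¬ T b → c ≢ b
      ∈∉⇒≢ c∈T b∉T refl = b∉T c∈T

    walk-stays-below : ∀ {b u v} → ¬ T b → WalkIn ReflexiveCycle T u v →
                       offset g u < offset g b → offset g v < offset g b
    walk-stays-below b∉T (here _)         u<b = u<b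
    walk-stays-below b∉T (step u∈T u~w w) u<b = walk-stays-below b∉T w
      (≤∧≢⇒< (≤-trans (offset-step g u~w (∈∉⇒≢ u∈T g∉T)) u<b)
              (∈∉⇒≢ (walk-head w) b∉T ∘ offset-injective g))

    stays-below : ∀ {b h z} → ¬ T b → T h → T z → offset g h < offset g b → offset g z < offset g b
    stays-below b∉T h∈T z∈T = walk-stays-below b∉T (T-conn _ _ h∈T z∈T)

    stays-above : ∀ {b h z} → ¬ T b → T h → T z → offset g b < offset g h → offset g b < offset g z
    stays-above {b} {h} {z} b∉T h∈T z∈T b<h with <-cmp (offset g z) (offset g b)
    ... | tri< z<b _ _ = ⊥-elim (<-asym b<h (stays-below b∉T z∈T h∈T z<b))
    ... | tri≈ _ z≡b _ = ⊥-elim (∈∉⇒≢ z∈T b∉T (offset-injective g z≡b))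
    ... | tri> _ _ b<z = b<z

    -- Seen from the boundary vertex g, the T-neighbour h₁ of g sits at offset 1 or p - 1,
    -- so T is trapped below b₂ or above b₃.
    boundary-ordered : ∀ {b₂ b₃} → ∃[ h ] (T h × Near h g) →
                       Boundary ReflexiveCycle T b₂ → Boundary ReflexiveCycle T b₃ →
                       b₂ ≢ g → offset g b₂ < offset g b₃ → ⊥
    boundary-ordered {b₂} {b₃} (h₁ , h₁∈T , h₁~g) (b₂∉T , h₂ , h₂∈T , h₂~b₂) (b₃∉T , h₃ , h₃∈T , h₃~b₃)
                     b₂≢g b₂<b₃
      with offset-near-origin g h₁~g (∈∉⇒≢ h₁∈T g∉T)
    ... | inj₁ h₁≤1 = <-irrefl refl (begin-strict
          offset g b₃       ≤⟨ offset-step g h₃~b₃ (∈∉⇒≢ h₃∈T g∉T) ⟩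
          suc (offset g h₃) ≤⟨ stays-below b₂∉T h₁∈T h₃∈T h₁<b₂ ⟩
          offset g b₂       <⟨ b₂<b₃ ⟩
          offset g b₃       ∎)
      where
      open ≤-Reasoning
      h₁<b₂ : offset g h₁ < offset g b₂
      h₁<b₂ = ≤∧≢⇒< (≤-trans h₁≤1 (n≢0⇒n>0 (offset≢0 g b₂≢g))) (∈∉⇒≢ h₁∈T b₂∉T ∘ offset-injective g)
    ... | inj₂ 1+h₁≡p = <-irrefl refl (begin-strict
          offset g b₃       <⟨ stays-above b₃∉T h₁∈T h₂∈T b₃<h₁ ⟩
          offset g h₂       ≤⟨ offset-step g (near-sym h₂~b₂) b₂≢g ⟩
          suc (offset g b₂) ≤⟨ b₂<b₃ ⟩
          offset g b₃       ∎)
      where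
      open ≤-Reasoning
      b₃<h₁ : offset g b₃ < offset g h₁
      b₃<h₁ = ≤∧≢⇒< (s≤s⁻¹ (subst (offset g b₃ <_) (sym 1+h₁≡p) (offset<p g b₃)))
                    (∈∉⇒≢ h₁∈T b₃∉T ∘ sym ∘ offset-injective g)

  cycle-boundary-at-most-two : ∀ {T} → Preconnected ReflexiveCycle T → (b : Fin 3 → Fin p) →
                               Injective _≡_ _≡_ b → (∀ i → Boundary ReflexiveCycle T (b i)) → ⊥
  cycle-boundary-at-most-two T-conn b b-inj ∂b with <-cmp (offset (b 0F) (b 1F)) (offset (b 0F) (b 2F))
  ... | tri< b₁<b₂ _ _ = boundary-ordered T-conn g∉T ∂g (∂b 1F) (∂b 2F) ((λ ()) ∘ b-inj) b₁<b₂
    where g∉T = proj₁ (∂b 0F) ; ∂g = proj₂ (∂b 0F)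
  ... | tri≈ _ b₁≡b₂ _ = ((λ ()) ∘ b-inj ∘ offset-injective (b 0F)) b₁≡b₂
  ... | tri> _ _ b₂<b₁ = boundary-ordered T-conn g∉T ∂g (∂b 2F) (∂b 1F) ((λ ()) ∘ b-inj) b₂<b₁
    where g∉T = proj₁ (∂b 0F) ; ∂g = proj₂ (∂b 0F)

  Vertex : Set
  Vertex = V (Bagel p)

  layer : Vertex → Fin 2
  layer = proj₁

  column : Vertex → Fin p
  column = proj₂

  column-near : ∀ {u v} → Adj (Bagel p) u v → Near (column u) (column v)
  column-near = proj₂

  bagel-sym : Symmetric (Adj (Bagel p))
  bagel-sym (u≢v , u~v) = u≢v ∘ sym , near-sym u~v

  bagel-≟ : DecidableEquality Vertex
  bagel-≟ = ≡-dec _≟_ _≟_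

  Meets : Subset Vertex → Subset (Fin p)
  Meets P c = ∃[ s ] P (s , c)

  meets-preconnected : ∀ {P} → Preconnected (Bagel p) P → Preconnected ReflexiveCycle (Meets P)
  meets-preconnected P-conn _ _ (_ , u∈P) (_ , v∈P) =
    walk-map column column-near (λ {v} v∈P → layer v , v∈P) (P-conn _ _ u∈P v∈P)

  meets⇒one-outside : ∀ {Q c s s′} → Meets Q c → ¬ Q (s , c) → ¬ Q (s′ , c) → s ≡ s′
  meets⇒one-outside {s = s} {s′} (s₀ , q) s∉Q s′∉Q with fin2-pigeonhole s₀ s s′
  ... | inj₁ refl        = ⊥-elim (s∉Q q)
  ... | inj₂ (inj₁ refl) = ⊥-elim (s′∉Q q)
  ... | inj₂ (inj₂ s≡s′) = s≡s′

  -- The layer condition decides between the two sides when P and Q both miss the column,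
  -- so that distinct vertices outside Q on the same side lie in distinct columns.
  Side : Subset Vertex → Subset Vertex → Fin 2 → Subset Vertex
  Side P Q r v = ¬ Meets P (column v) × (Meets Q (column v) ⊎ layer v ≡ r)

  side-of : ∀ {P Q v} → Disjoint P Q → ¬ P v → ¬ Q v →
            Dec (Meets P (column v)) → Dec (Meets Q (column v)) → Side P Q 0F v ⊎ Side Q P 1F v
  side-of {P} {Q} {s , c} P∩Q=∅ v∉P v∉Q (yes P-meets) (yes (s₂ , x₂)) =
    ⊥-elim (v∉Q (subst (λ s′ → Q (s′ , c)) s₂≡s x₂))
    where s₂≡s = meets⇒one-outside {P} P-meets (λ x₂∈P → P∩Q=∅ _ x₂∈P x₂) v∉P
  side-of              _ _ _ (yes P-meets) (no  ¬Q-meets) = inj₂ (¬Q-meets , inj₁ P-meets)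
  side-of              _ _ _ (no ¬P-meets) (yes Q-meets)  = inj₁ (¬P-meets , inj₁ Q-meets)
  side-of {v = 0F , _} _ _ _ (no ¬P-meets) (no _)         = inj₁ (¬P-meets , inj₂ refl)
  side-of {v = 1F , _} _ _ _ (no _)        (no ¬Q-meets)  = inj₂ (¬Q-meets , inj₂ refl)

  ¬¬-side : ∀ {P Q v} → Disjoint P Q → ¬ P v → ¬ Q v → ¬ ¬ (Side P Q 0F v ⊎ Side Q P 1F v)
  ¬¬-side P∩Q=∅ v∉P v∉Q k =
    ¬¬-excluded-middle λ P? → ¬¬-excluded-middle λ Q? → k (side-of P∩Q=∅ v∉P v∉Q P? Q?)

  side-column-injective : ∀ {P Q r u v} → Side P Q r u → Side P Q r v → ¬ Q u → ¬ Q v →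
                          column u ≡ column v → u ≡ v
  side-column-injective {Q = Q} {u = _ , c} (_ , inj₁ Q-meets) _ u∉Q v∉Q refl =
    cong (_, c) (meets⇒one-outside {Q} Q-meets u∉Q v∉Q)
  side-column-injective {Q = Q} {u = _ , c} (_ , inj₂ _) (_ , inj₁ Q-meets) u∉Q v∉Q refl =
    cong (_, c) (meets⇒one-outside {Q} Q-meets u∉Q v∉Q)
  side-column-injective (_ , inj₂ refl) (_ , inj₂ refl) _ _ refl = refl

  no-three-on-one-side : ∀ {P Q r} → Preconnected (Bagel p) P →
                         (z : Fin 3 → Vertex) → Injective _≡_ _≡_ z → (∀ i → ¬ Q (z i)) →
                         (∀ i → Side P Q r (z i)) → (∀ i → ∃[ h ] (P h × Adj (Bagel p) h (z i))) → ⊥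
  no-three-on-one-side {P} {Q} P-conn z z-inj z∉Q z-side z-edge =
    cycle-boundary-at-most-two (meets-preconnected P-conn) (column ∘ z)
      (z-inj ∘ side-column-injective {P} {Q} (z-side _) (z-side _) (z∉Q _) (z∉Q _)) ∂P
    where
    ∂P : ∀ i → Boundary ReflexiveCycle (Meets P) (column (z i))
    ∂P i = let h , h∈P , h~z = z-edge i in proj₁ (z-side i) , column h , (layer h , h∈P) , column-near h~z

  bagel-no-singleton-K25 : ¬ SingletonK2tMinor (Bagel p) 5
  bagel-no-singleton-K25 m =
    ¬¬-Π-Fin (λ j → ¬¬-side AB-disj (y∉A j) (y∉B j)) λ sides →
      [ one-side {Q = B} A-conn y∉B A-edge , one-side {Q = A} B-conn y∉A B-edge ]′
        (pigeonhole-⊎ 2 2 ≤-refl sides)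
    where
    open SingletonK2tMinor m
    one-side : ∀ {P Q r} → Preconnected (Bagel p) P → (∀ j → ¬ Q (y j)) →
               (∀ j → ∃[ h ] (P h × Adj (Bagel p) h (y j))) → AtLeast 3 (λ j → Side P Q r (y j)) → ⊥
    one-side {P} {Q} P-conn y∉Q y-edge (ι , ι-inj , on-side) =
      no-three-on-one-side {P} {Q} P-conn (y ∘ ι) (ι-inj ∘ y-inj) (y∉Q ∘ ι) on-side (y-edge ∘ ι)

mainTheorem4 : (n p : ℕ) .{{_ : NonZero p}} → n ≡ 2 * p → 6 ≤ n → ¬ RootedK2tMinor (Bagel p) (AllRoots (Bagel p)) 5
mainTheorem4 _ p _ _ = bagel-no-singleton-K25 p ∘ singleton-minor (bagel-sym p) (bagel-≟ p)
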